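{- As $n\to\infty$, \[ a_n=\mathcal{O}\!\left(n^{ -1}\left(\frac{12}{e}\right)^nn^{n}\right). \]
   Context: For $n\geq1$, $\mathcal{A}_n$ is the set of words over the alphabet $\{\omega_1,\ldots,\omega_n\}$ in which every letter occurs exactly $3$ times and such that in every prefix, for every $i$, either $\omega_i$ does not occur in the prefix or the number of occurrences of $\omega_i$ in the prefix is at least the number of occurrences of $\omega_j$ in the prefix for every $j>i$; $a_n=|\mathcal{A}_n|$. -}

module Defs where

open import Data.Nat using (ℕ; zero; suc; _+_; _*_; _^_; _≤_; _≤?_; _/_; _!)
open import Data.Nat.Properties using (_!≢0)
import Data.Nat.Properties as ℕP
open import Data.Fin using (Fin) renaming (_<_ to _<ᶠ_)
open import Data.Fin.Properties using (all?) renaming (_≟_ to _≟ᶠ_; _<?_ to _<ᶠ?_)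
open import Data.List using (List; []; _∷_; allFin; length; filter; map; concatMap; inits; upTo)
open import Data.Nat.ListAction using (sum)
open import Data.List.Relation.Unary.All using (All)
import Data.List.Relation.Unary.All as All
open import Data.Product using (_×_)
open import Data.Sum using (_⊎_)
open import Relation.Binary.PropositionalEquality using (_≡_)
open import Relation.Nullary using (Dec; yes; no)
open import Relation.Nullary.Decidable using (_×-dec_; _⊎-dec_; _→-dec_)

-- Words over the alphabet {ω_1,…,ω_n}, letter ω_(i+1) encoded as i : Fin n.
Word : ℕ → Set
Word n = List (Fin n)

occ : ∀ {n} → Fin n → Word n → ℕ
occ i w = length (filter (i ≟ᶠ_) w)

PrefixOK : ∀ {n} → Word n → Set
PrefixOK p = ∀ i → occ i p ≡ 0 ⊎ (∀ j → i <ᶠ j → occ j p ≤ occ i p)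

InA : (n : ℕ) → Word n → Set
InA n w = (∀ i → occ i w ≡ 3) × All PrefixOK (inits w)

prefixOK? : ∀ {n} (p : Word n) → Dec (PrefixOK p)
prefixOK? p = all? λ i → (occ i p ℕP.≟ 0) ⊎-dec all? (λ j → (i <ᶠ? j) →-dec (occ j p ≤? occ i p))

inA? : (n : ℕ) (w : Word n) → Dec (InA n w)
inA? n w = all? (λ i → occ i w ℕP.≟ 3) ×-dec All.all? prefixOK? (inits w)

allWords : (n L : ℕ) → List (Word n)
allWords n zero = [] ∷ []
allWords n (suc L) = concatMap (λ w → map (_∷ w) (allFin n)) (allWords n L)

-- a_n = |𝒜_n|; words in 𝒜_n have length exactly 3n
a : ℕ → ℕ
a n = length (filter (inA? n) (allWords n (3 * n)))

-- K! · Σ_{k=0}^{K} x^k / k!   (each K!/k! is an exact natural number);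
-- these increase in K to K!-scaled partial sums of e^x.
expPartialScaled : ℕ → ℕ → ℕ
expPartialScaled x K = sum (map (λ k → x ^ k * ((K !) / (k !)) {{k !≢0}}) (upTo (suc K)))

-- Erasing the largest letter ωₙ from a word of 𝒜ₙ leaves a word v of 𝒜ₙ₋₁, which the three
-- copies of ωₙ cut into α β δ (nothing follows the third copy). By the prefix condition ωₙ₋₁
-- occurs twice before the second ωₙ, so δ lies inside the part of v after its second ωₙ₋₁; let
-- t(v) be the length of that part. Weighting every word w by 2 ^ t(w), the words above v weigh
-- Σ_{d ≤ t(v)} (3n − 2 − d) · 2 ^ (d + 1) ≤ 12 (n − 2) · 2 ^ t(v) for large n, so the weighted
-- count Wₙ ≥ aₙ satisfies Wₙ ≤ 12 (n − 2) Wₙ₋₁ and aₙ = O(12ⁿ (n − 2)!). Finally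
-- n! · Σₖ nᵏ / k! ≤ (2n + 2) nⁿ turns (n − 2)! · n · eⁿ into O(nⁿ).
module Submission where

open import Defs
open import Data.Nat using (ℕ; zero; suc; _+_; _*_; _^_; _≤_; _<_; _∸_; _!; z≤n; s≤s; s≤s⁻¹; _≤?_; _/_)
open import Data.Nat.Properties
open import Data.Nat.ListAction using (sum)
open import Data.Nat.ListAction.Properties using (sum-++)
open import Data.Nat.DivMod using (*-/-assoc; n/n≡1)
open import Data.Nat.Divisibility using (m≤n⇒m!∣n!)
open import Data.Fin using (Fin; fromℕ; inject₁) renaming (zero to fzero; suc to fsuc; _<_ to _<ᶠ_)
import Data.Fin.Properties as Fin
open import Data.Fin.Properties using () renaming (_≟_ to _≟ᶠ_)
open import Data.List using (List; []; _∷_; _++_; length; map; filter; concatMap; take; drop; allFin; inits; upTo; cartesianProductWith)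
import Data.List.Properties as List
open import Data.List.Relation.Unary.All using (All; []; _∷_)
import Data.List.Relation.Unary.All as All
import Data.List.Relation.Unary.All.Properties as All
open import Data.List.Relation.Unary.Any using (here; there)
open import Data.List.Membership.Propositional using (_∈_; lose)
import Data.List.Membership.Propositional.Properties as ∈
open import Data.List.Relation.Unary.Unique.Propositional using (Unique)
import Data.List.Relation.Unary.AllPairs as AllPairs
import Data.List.Relation.Unary.Unique.Propositional.Properties as Unique
open import Data.Maybe using (Maybe; just; nothing)
import Data.Maybe as Maybe
open import Data.Product using (∃; ∃₂; _×_; _,_; proj₁; proj₂)
open import Data.Sum using (_⊎_; inj₁; inj₂)
open import Function using (_∘_)
open import Relation.Binary.PropositionalEquality
import Algebra.Properties.CommutativeSemigroup +-commutativeSemigroup as +-CS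
import Algebra.Properties.CommutativeSemigroup *-commutativeSemigroup as *-CS
open import Data.Nat.Tactic.RingSolver using (solve-∀)
open import Relation.Nullary using (Dec; yes; no; contradiction)

private
  variable
    A B : Set
    k m n : ℕ

sumBy : (A → ℕ) → List A → ℕ
sumBy f xs = sum (map f xs)

sumBy-++ : ∀ (f : A → ℕ) xs ys → sumBy f (xs ++ ys) ≡ sumBy f xs + sumBy f ys
sumBy-++ f xs ys = trans (cong sum (List.map-++ f xs ys)) (sum-++ (map f xs) (map f ys))

sumBy-map : ∀ (f : B → ℕ) (g : A → B) xs → sumBy f (map g xs) ≡ sumBy (f ∘ g) xs
sumBy-map f g xs = cong sum (sym (List.map-∘ xs))

sumBy-concatMap : ∀ (f : B → ℕ) (g : A → List B) xs →
                  sumBy f (concatMap g xs) ≡ sumBy (sumBy f ∘ g) xs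
sumBy-concatMap f g []       = refl
sumBy-concatMap f g (x ∷ xs) =
  trans (sumBy-++ f (g x) (concatMap g xs)) (cong (sumBy f (g x) +_) (sumBy-concatMap f g xs))

sumBy-const : ∀ c (xs : List A) → sumBy (λ _ → c) xs ≡ length xs * c
sumBy-const c []       = refl
sumBy-const c (x ∷ xs) = cong (c +_) (sumBy-const c xs)

sumBy-*ˡ : ∀ c (f : A → ℕ) xs → sumBy (λ x → c * f x) xs ≡ c * sumBy f xs
sumBy-*ˡ c f []       = sym (*-zeroʳ c)
sumBy-*ˡ c f (x ∷ xs) = trans (cong (c * f x +_) (sumBy-*ˡ c f xs)) (sym (*-distribˡ-+ c (f x) _))

sumBy-cong : ∀ {f g : A → ℕ} xs → (∀ {x} → x ∈ xs → f x ≡ g x) → sumBy f xs ≡ sumBy g xs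
sumBy-cong []       f≡g = refl
sumBy-cong (x ∷ xs) f≡g = cong₂ _+_ (f≡g (here refl)) (sumBy-cong xs (f≡g ∘ there))

sumBy-mono : ∀ {f g : A → ℕ} xs → (∀ {x} → x ∈ xs → f x ≤ g x) → sumBy f xs ≤ sumBy g xs
sumBy-mono []       f≤g = z≤n
sumBy-mono (x ∷ xs) f≤g = +-mono-≤ (f≤g (here refl)) (sumBy-mono xs (f≤g ∘ there))

sumBy-⊆ : ∀ (f : A → ℕ) {xs} ys → Unique xs → (∀ {x} → x ∈ xs → x ∈ ys) → sumBy f xs ≤ sumBy f ys
sumBy-⊆ f {[]}     ys _                 _    = z≤n
sumBy-⊆ f {x ∷ xs} ys (x∉xs AllPairs.∷ u) xs⊆ys with ∈.∈-∃++ (xs⊆ys (here refl))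
... | ys₁ , ys₂ , refl = begin
  f x + sumBy f xs                    ≤⟨ +-monoʳ-≤ (f x) (sumBy-⊆ f (ys₁ ++ ys₂) u xs⊆ys₁ys₂) ⟩
  f x + sumBy f (ys₁ ++ ys₂)          ≡⟨ cong (f x +_) (sumBy-++ f ys₁ ys₂) ⟩
  f x + (sumBy f ys₁ + sumBy f ys₂)   ≡⟨ +-CS.x∙yz≈y∙xz (f x) (sumBy f ys₁) (sumBy f ys₂) ⟩
  sumBy f ys₁ + (f x + sumBy f ys₂)   ≡⟨ sym (sumBy-++ f ys₁ (x ∷ ys₂)) ⟩
  sumBy f (ys₁ ++ x ∷ ys₂)            ∎
  where
  open ≤-Reasoning
  xs⊆ys₁ys₂ : ∀ {z} → z ∈ xs → z ∈ ys₁ ++ ys₂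
  xs⊆ys₁ys₂ z∈xs with ∈.∈-++⁻ ys₁ (xs⊆ys (there z∈xs))
  ... | inj₁ z∈ys₁         = ∈.∈-++⁺ˡ z∈ys₁
  ... | inj₂ (here refl)   = contradiction refl (All.lookup x∉xs z∈xs)
  ... | inj₂ (there z∈ys₂) = ∈.∈-++⁺ʳ ys₁ z∈ys₂

occ-here : ∀ (i : Fin n) w → occ i (i ∷ w) ≡ suc (occ i w)
occ-here i w = cong length (List.filter-accept (i ≟ᶠ_) {xs = w} refl)

occ-there : ∀ {i j : Fin n} w → i ≢ j → occ i (j ∷ w) ≡ occ i w
occ-there {i = i} w i≢j = cong length (List.filter-reject (i ≟ᶠ_) {xs = w} i≢j)

occ-++ : ∀ (i : Fin n) u w → occ i (u ++ w) ≡ occ i u + occ i w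
occ-++ i u w = trans (cong length (List.filter-++ (i ≟ᶠ_) u w)) (List.length-++ (filter (i ≟ᶠ_) u))

occ≡0⇒≢ : ∀ {i j : Fin n} w → occ i (j ∷ w) ≡ 0 → i ≢ j
occ≡0⇒≢ {i = i} w eq refl = 1+n≢0 (trans (sym (occ-here i w)) eq)

split-at-first : ∀ (x : Fin n) w {c} → occ x w ≡ suc c →
                 ∃₂ λ u s → w ≡ u ++ x ∷ s × occ x u ≡ 0 × occ x s ≡ c
split-at-first x []      ()
split-at-first x (y ∷ w) {c} eq = by-cases (x ≟ᶠ y)
  where
  by-cases : Dec (x ≡ y) → ∃₂ λ u s → y ∷ w ≡ u ++ x ∷ s × occ x u ≡ 0 × occ x s ≡ c
  by-cases (yes refl) = [] , w , refl , refl , suc-injective (trans (sym (occ-here x w)) eq)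
  by-cases (no x≢y) with split-at-first x w (trans (sym (occ-there w x≢y)) eq)
  ... | u , s , refl , occ-u , occ-s = y ∷ u , s , refl , trans (occ-there u x≢y) occ-u , occ-s

All-inits⇒prefix : ∀ {P : List A → Set} p s → All P (inits (p ++ s)) → P p
All-inits⇒prefix []      s (Pp ∷ _)  = Pp
All-inits⇒prefix (x ∷ p) s (_  ∷ Ps) = All-inits⇒prefix p s (All.map⁻ Ps)

prefix⇒All-inits : ∀ {P : List A → Set} w → (∀ p s → w ≡ p ++ s → P p) → All P (inits w)
prefix⇒All-inits []      P-pre = P-pre [] [] refl ∷ []
prefix⇒All-inits (x ∷ w) P-pre =
  P-pre [] (x ∷ w) refl ∷ All.map⁺ (prefix⇒All-inits w λ p s eq → P-pre (x ∷ p) s (cong (x ∷_) eq))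

InA⇒PrefixOK : ∀ {w : Word n} → InA n w → ∀ p s → w ≡ p ++ s → PrefixOK p
InA⇒PrefixOK (_ , prefixes) p s refl = All-inits⇒prefix p s prefixes

-- Since x occurs in a word of 𝒜ₙ, a prefix where x is still absent extends to one ending in the
-- first x, where j can have occurred at most once.
occ-larger-bound : ∀ {w : Word n} {x j} → InA n w → ∀ p s → w ≡ p ++ s → x <ᶠ j →
                   occ j p ≤ 1 ⊎ occ j p ≤ occ x p
occ-larger-bound {n = n} {w = w} {x} {j} w∈𝒜 p s refl x<j with InA⇒PrefixOK w∈𝒜 p s refl x
... | inj₂ x-dominates = inj₂ (x-dominates j x<j)
... | inj₁ occ-x-p≡0 with split-at-first x s occ-x-s≡3
  where
  occ-x-s≡3 : occ x s ≡ 3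
  occ-x-s≡3 = trans (sym (cong (_+ occ x s) occ-x-p≡0)) (trans (sym (occ-++ x p s)) (proj₁ w∈𝒜 x))
...   | u , t , refl , occ-x-u≡0 , _ = inj₁ (begin
  occ j p              ≤⟨ m≤m+n (occ j p) (occ j q) ⟩
  occ j p + occ j q    ≡⟨ sym (occ-++ j p q) ⟩
  occ j (p ++ q)       ≤⟨ j≤x (InA⇒PrefixOK w∈𝒜 (p ++ q) t w≡pq++t x) ⟩
  1                    ∎)
  where
  open ≤-Reasoning
  q : Word n
  q = u ++ x ∷ []
  w≡pq++t : p ++ u ++ x ∷ t ≡ (p ++ q) ++ t
  w≡pq++t = sym (trans (List.++-assoc p q t) (cong (p ++_) (List.++-assoc u (x ∷ []) t)))
  occ-x-pq≡1 : occ x (p ++ q) ≡ 1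
  occ-x-pq≡1 = trans (occ-++ x p q) (cong₂ _+_ occ-x-p≡0 (trans (occ-++ x u (x ∷ [])) (cong₂ _+_ occ-x-u≡0 (occ-here x []))))
  j≤x : occ x (p ++ q) ≡ 0 ⊎ (∀ k → x <ᶠ k → occ k (p ++ q) ≤ occ x (p ++ q)) → occ j (p ++ q) ≤ 1
  j≤x (inj₁ occ≡0)       = contradiction (trans (sym occ-x-pq≡1) occ≡0) 1+n≢0
  j≤x (inj₂ x-dominates) = subst (occ j (p ++ q) ≤_) occ-x-pq≡1 (x-dominates j x<j)

-- Erasing the largest letter

inject₁≢fromℕ : (i : Fin m) → inject₁ i ≢ fromℕ m
inject₁≢fromℕ i = Fin.fromℕ≢inject₁ ∘ sym

≢fromℕ⇒<fromℕ : (x : Fin (suc m)) → x ≢ fromℕ m → x <ᶠ fromℕ m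
≢fromℕ⇒<fromℕ x = Fin.≤∧≢⇒< (Fin.≤fromℕ x)

inject₁<fromℕ : (i : Fin m) → inject₁ i <ᶠ fromℕ m
inject₁<fromℕ i = ≢fromℕ⇒<fromℕ (inject₁ i) (inject₁≢fromℕ i)

inject₁-mono-< : {i j : Fin m} → i <ᶠ j → inject₁ i <ᶠ inject₁ j
inject₁-mono-< {i = i} {j} = subst₂ _<_ (sym (Fin.toℕ-inject₁ i)) (sym (Fin.toℕ-inject₁ j))

lower₁? : Fin (suc m) → Maybe (Fin m)
lower₁? {zero}  fzero    = nothing
lower₁? {suc m} fzero    = just fzero
lower₁? {suc m} (fsuc i) = Maybe.map fsuc (lower₁? i)

lower₁?-inject₁ : (i : Fin m) → lower₁? (inject₁ i) ≡ just i
lower₁?-inject₁ {suc m} fzero    = refl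
lower₁?-inject₁ {suc m} (fsuc i) = cong (Maybe.map fsuc) (lower₁?-inject₁ i)

lower₁?-fromℕ : ∀ m → lower₁? (fromℕ m) ≡ nothing
lower₁?-fromℕ zero    = refl
lower₁?-fromℕ (suc m) = cong (Maybe.map fsuc) (lower₁?-fromℕ m)

lower₁?≡just⇒ : (x : Fin (suc m)) {i : Fin m} → lower₁? x ≡ just i → x ≡ inject₁ i
lower₁?≡just⇒ {suc m} fzero    refl = refl
lower₁?≡just⇒ {suc m} (fsuc x) eq with lower₁? x in e
lower₁?≡just⇒ {suc m} (fsuc x) refl | just j = cong fsuc (lower₁?≡just⇒ x e)

lower₁?≡nothing⇒ : (x : Fin (suc m)) → lower₁? x ≡ nothing → x ≡ fromℕ m
lower₁?≡nothing⇒ {zero}  fzero    _  = refl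
lower₁?≡nothing⇒ {suc m} (fsuc x) eq with lower₁? x in e
lower₁?≡nothing⇒ {suc m} (fsuc x) refl | nothing = cong fsuc (lower₁?≡nothing⇒ x e)

eraseMax : Word (suc m) → Word m
eraseMax []      = []
eraseMax (x ∷ w) with lower₁? x
... | just i  = i ∷ eraseMax w
... | nothing = eraseMax w

eraseMax-++ : (u w : Word (suc m)) → eraseMax (u ++ w) ≡ eraseMax u ++ eraseMax w
eraseMax-++ []      w = refl
eraseMax-++ (x ∷ u) w with lower₁? x
... | just i  = cong (i ∷_) (eraseMax-++ u w)
... | nothing = eraseMax-++ u w

eraseMax-inject₁ : (w : Word m) → eraseMax (map inject₁ w) ≡ w
eraseMax-inject₁ []      = refl
eraseMax-inject₁ (x ∷ w) rewrite lower₁?-inject₁ x = cong (x ∷_) (eraseMax-inject₁ w)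

eraseMax-fromℕ : (w : Word (suc m)) → eraseMax (fromℕ m ∷ w) ≡ eraseMax w
eraseMax-fromℕ {m} w rewrite lower₁?-fromℕ m = refl

occ-eraseMax : (i : Fin m) (w : Word (suc m)) → occ i (eraseMax w) ≡ occ (inject₁ i) w
occ-eraseMax i []      = refl
occ-eraseMax i (x ∷ w) with lower₁? x in e
... | just j  with refl ← lower₁?≡just⇒ x e = by-cases (i ≟ᶠ j)
  where
  by-cases : Dec (i ≡ j) → occ i (j ∷ eraseMax w) ≡ occ (inject₁ i) (inject₁ j ∷ w)
  by-cases (yes refl) = trans (occ-here i _) (trans (cong suc (occ-eraseMax i w)) (sym (occ-here _ w)))
  by-cases (no i≢j)   = trans (occ-there _ i≢j)
                          (trans (occ-eraseMax i w) (sym (occ-there w (i≢j ∘ Fin.inject₁-injective))))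
... | nothing with refl ← lower₁?≡nothing⇒ x e = trans (occ-eraseMax i w) (sym (occ-there w (inject₁≢fromℕ i)))

occ-fromℕ-inject₁ : (w : Word m) → occ (fromℕ m) (map inject₁ w) ≡ 0
occ-fromℕ-inject₁ []      = refl
occ-fromℕ-inject₁ (x ∷ w) = trans (occ-there _ (inject₁≢fromℕ x ∘ sym)) (occ-fromℕ-inject₁ w)

occ-fromℕ≡0⇒inject₁ : (w : Word (suc m)) → occ (fromℕ m) w ≡ 0 → w ≡ map inject₁ (eraseMax w)
occ-fromℕ≡0⇒inject₁ []      _  = refl
occ-fromℕ≡0⇒inject₁ {m} (x ∷ w) eq with lower₁? x in e
... | just j  with refl ← lower₁?≡just⇒ x e =
  cong (inject₁ j ∷_) (occ-fromℕ≡0⇒inject₁ w (trans (sym (occ-there w (inject₁≢fromℕ j ∘ sym))) eq))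
... | nothing with refl ← lower₁?≡nothing⇒ x e = contradiction refl (occ≡0⇒≢ {i = fromℕ m} w eq)

eraseMax-prefix : (w : Word (suc m)) (p s : Word m) → eraseMax w ≡ p ++ s →
                  ∃₂ λ p′ s′ → w ≡ p′ ++ s′ × eraseMax p′ ≡ p
eraseMax-prefix w       []      s _  = [] , w , refl , refl
eraseMax-prefix []      (y ∷ p) s ()
eraseMax-prefix (x ∷ w) (y ∷ p) s eq with lower₁? x in e
... | just i with refl , eq′ ← List.∷-injective eq with p′ , s′ , refl , erase-p′ ← eraseMax-prefix w p s eq′ =
  x ∷ p′ , s′ , refl , trans erase-x∷p′ (cong (i ∷_) erase-p′)
  where
  erase-x∷p′ : eraseMax (x ∷ p′) ≡ i ∷ eraseMax p′
  erase-x∷p′ rewrite e = refl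
... | nothing with p′ , s′ , refl , erase-p′ ← eraseMax-prefix w (y ∷ p) s eq =
  x ∷ p′ , s′ , refl , trans erase-x∷p′ erase-p′
  where
  erase-x∷p′ : eraseMax (x ∷ p′) ≡ eraseMax p′
  erase-x∷p′ rewrite e = refl

PrefixOK-eraseMax : (p : Word (suc m)) → PrefixOK p → PrefixOK (eraseMax p)
PrefixOK-eraseMax p ok i with ok (inject₁ i)
... | inj₁ occ≡0       = inj₁ (trans (occ-eraseMax i p) occ≡0)
... | inj₂ i-dominates = inj₂ λ j i<j →
  subst₂ _≤_ (sym (occ-eraseMax j p)) (sym (occ-eraseMax i p)) (i-dominates (inject₁ j) (inject₁-mono-< i<j))

InA-eraseMax : (w : Word (suc m)) → InA (suc m) w → InA m (eraseMax w)
InA-eraseMax w w∈𝒜@(occ≡3 , _) =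
  (λ i → trans (occ-eraseMax i w) (occ≡3 (inject₁ i))) , prefix⇒All-inits (eraseMax w) prefixOK
  where
  prefixOK : ∀ p s → eraseMax w ≡ p ++ s → PrefixOK p
  prefixOK p s eq with p′ , s′ , w≡p′s′ , erase-p′ ← eraseMax-prefix w p s eq =
    subst PrefixOK erase-p′ (PrefixOK-eraseMax p′ (InA⇒PrefixOK w∈𝒜 p′ s′ w≡p′s′))

-- Decomposition of words of 𝒜ₙ₊₁

eraseMax-++-fromℕ : (u w : Word (suc m)) → eraseMax (u ++ fromℕ m ∷ w) ≡ eraseMax u ++ eraseMax w
eraseMax-++-fromℕ u w = trans (eraseMax-++ u _) (cong (eraseMax u ++_) (eraseMax-fromℕ w))

occ-fromℕ-++-fromℕ : (u w : Word (suc m)) → occ (fromℕ m) u ≡ 0 →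
                     occ (fromℕ m) (u ++ fromℕ m ∷ w) ≡ suc (occ (fromℕ m) w)
occ-fromℕ-++-fromℕ u w occ-u≡0 = trans (occ-++ _ u _) (cong₂ _+_ occ-u≡0 (occ-here _ w))

insertMax : Word m → Word m → Word m → Word (suc m)
insertMax {m} α β δ = map inject₁ α ++ fromℕ m ∷ map inject₁ β ++ fromℕ m ∷ map inject₁ δ ++ fromℕ m ∷ []

eraseMax-insertMax : (α β δ : Word m) → eraseMax (insertMax α β δ) ≡ α ++ β ++ δ
eraseMax-insertMax α β δ = begin
  eraseMax (insertMax α β δ)
    ≡⟨ eraseMax-++-fromℕ (map inject₁ α) _ ⟩
  eraseMax (map inject₁ α) ++ eraseMax (map inject₁ β ++ _)
    ≡⟨ cong (eraseMax (map inject₁ α) ++_) (eraseMax-++-fromℕ (map inject₁ β) _) ⟩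
  eraseMax (map inject₁ α) ++ eraseMax (map inject₁ β) ++ eraseMax (map inject₁ δ ++ _)
    ≡⟨ cong (λ r → eraseMax (map inject₁ α) ++ eraseMax (map inject₁ β) ++ r) (eraseMax-++-fromℕ (map inject₁ δ) []) ⟩
  eraseMax (map inject₁ α) ++ eraseMax (map inject₁ β) ++ eraseMax (map inject₁ δ) ++ []
    ≡⟨ cong₂ _++_ (eraseMax-inject₁ α) (cong₂ _++_ (eraseMax-inject₁ β)
         (trans (List.++-identityʳ _) (eraseMax-inject₁ δ))) ⟩
  α ++ β ++ δ ∎
  where open ≡-Reasoning

suffix-after-complete-max≡[] : ∀ {w : Word (suc m)} → InA (suc m) w → ∀ p s → w ≡ p ++ s →
                               occ (fromℕ m) p ≡ 3 → occ (fromℕ m) s ≡ 0 → s ≡ []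
suffix-after-complete-max≡[]         w∈𝒜 p []      _ _      _         = refl
suffix-after-complete-max≡[] {m} {w} w∈𝒜 p (x ∷ s) refl occ-p≡3 occ-s≡0
  with occ-larger-bound w∈𝒜 p (x ∷ s) refl (≢fromℕ⇒<fromℕ x (occ≡0⇒≢ s occ-s≡0 ∘ sym))
... | inj₁ 3≤1  = contradiction (subst (_≤ 1) occ-p≡3 3≤1) λ { (s≤s ()) }
... | inj₂ 3≤x = contradiction (proj₁ w∈𝒜 x) (>⇒≢ (begin-strict
  3                          ≤⟨ subst (_≤ occ x p) occ-p≡3 3≤x ⟩
  occ x p                    <⟨ m<m+n (occ x p) (s≤s z≤n) ⟩
  occ x p + suc (occ x s)    ≡⟨ cong (occ x p +_) (occ-here x s) ⟨
  occ x p + occ x (x ∷ s)    ≡⟨ occ-++ x p (x ∷ s) ⟨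
  occ x w                    ∎))
  where open ≤-Reasoning

max-positions : ∀ {w : Word (suc m)} → InA (suc m) w →
  ∃₂ λ u₁ u₂ → ∃ λ u₃ → w ≡ u₁ ++ fromℕ m ∷ u₂ ++ fromℕ m ∷ u₃ ++ fromℕ m ∷ [] ×
    occ (fromℕ m) u₁ ≡ 0 × occ (fromℕ m) u₂ ≡ 0 × occ (fromℕ m) u₃ ≡ 0
max-positions {m} {w} w∈𝒜 with split-at-first (fromℕ m) w (proj₁ w∈𝒜 (fromℕ m))
... | u₁ , s₁ , refl , o₁ , os₁ with split-at-first (fromℕ m) s₁ os₁
... | u₂ , s₂ , refl , o₂ , os₂ with split-at-first (fromℕ m) s₂ os₂
... | u₃ , s₃ , refl , o₃ , os₃ = u₁ , u₂ , u₃ , cong (λ s → u₁ ++ ω ∷ u₂ ++ ω ∷ u₃ ++ ω ∷ s) s₃≡[] , o₁ , o₂ , o₃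
  where
  ω : Fin (suc m)
  ω = fromℕ m
  p : Word (suc m)
  p = u₁ ++ ω ∷ u₂ ++ ω ∷ u₃ ++ ω ∷ []
  w≡p++s₃ : u₁ ++ ω ∷ u₂ ++ ω ∷ u₃ ++ ω ∷ s₃ ≡ p ++ s₃
  w≡p++s₃ = sym (trans (List.++-assoc u₁ _ s₃) (cong (λ r → u₁ ++ ω ∷ r)
                  (trans (List.++-assoc u₂ _ s₃) (cong (λ r → u₂ ++ ω ∷ r) (List.++-assoc u₃ _ s₃)))))
  occ-p≡3 : occ ω p ≡ 3
  occ-p≡3 = trans (occ-fromℕ-++-fromℕ u₁ _ o₁)
              (cong suc (trans (occ-fromℕ-++-fromℕ u₂ _ o₂) (cong suc (occ-fromℕ-++-fromℕ u₃ [] o₃))))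
  s₃≡[] : s₃ ≡ []
  s₃≡[] = suffix-after-complete-max≡[] w∈𝒜 p s₃ w≡p++s₃ occ-p≡3 os₃

decompose : (w : Word (suc (suc k))) → InA (suc (suc k)) w →
            ∃₂ λ α β → ∃ λ δ → w ≡ insertMax α β δ × 2 ≤ occ (fromℕ k) (α ++ β)
decompose {k} w w∈𝒜 with u₁ , u₂ , u₃ , refl , o₁ , o₂ , o₃ ← max-positions w∈𝒜 =
  eraseMax u₁ , eraseMax u₂ , eraseMax u₃ , w≡insertMax , second-max-twice
  where
  ω : Fin (suc (suc k))
  ω = fromℕ (suc k)
  w≡insertMax : u₁ ++ ω ∷ u₂ ++ ω ∷ u₃ ++ ω ∷ [] ≡ insertMax (eraseMax u₁) (eraseMax u₂) (eraseMax u₃)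
  w≡insertMax = cong₂ (λ x y → x ++ ω ∷ y) (occ-fromℕ≡0⇒inject₁ u₁ o₁)
                  (cong₂ (λ x y → x ++ ω ∷ y) (occ-fromℕ≡0⇒inject₁ u₂ o₂)
                    (cong (_++ ω ∷ []) (occ-fromℕ≡0⇒inject₁ u₃ o₃)))
  p : Word (suc (suc k))
  p = u₁ ++ ω ∷ u₂ ++ ω ∷ []
  w≡p++s : u₁ ++ ω ∷ u₂ ++ ω ∷ u₃ ++ ω ∷ [] ≡ p ++ u₃ ++ ω ∷ []
  w≡p++s = sym (trans (List.++-assoc u₁ _ _) (cong (λ r → u₁ ++ ω ∷ r) (List.++-assoc u₂ _ _)))
  occ-p≡2 : occ ω p ≡ 2
  occ-p≡2 = trans (occ-fromℕ-++-fromℕ u₁ _ o₁) (cong suc (occ-fromℕ-++-fromℕ u₂ [] o₂))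
  occ-second-max : occ (fromℕ k) (eraseMax u₁ ++ eraseMax u₂) ≡ occ (inject₁ (fromℕ k)) p
  occ-second-max = trans (cong (occ (fromℕ k)) (sym erase-p)) (occ-eraseMax (fromℕ k) p)
    where
    erase-p : eraseMax p ≡ eraseMax u₁ ++ eraseMax u₂
    erase-p = trans (eraseMax-++-fromℕ u₁ _)
                (cong (eraseMax u₁ ++_) (trans (eraseMax-++-fromℕ u₂ []) (List.++-identityʳ _)))
  second-max-twice : 2 ≤ occ (fromℕ k) (eraseMax u₁ ++ eraseMax u₂)
  second-max-twice with occ-larger-bound w∈𝒜 p _ w≡p++s (inject₁<fromℕ (fromℕ k))
  ... | inj₁ 2≤1 = contradiction (subst (_≤ 1) occ-p≡2 2≤1) λ { (s≤s ()) }
  ... | inj₂ 2≤M = subst₂ _≤_ occ-p≡2 (sym occ-second-max) 2≤M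

-- Letters after the second occurrence of the largest letter

suffixAfter : ℕ → Fin n → Word n → Word n
suffixAfter zero    x w       = w
suffixAfter (suc c) x []      = []
suffixAfter (suc c) x (y ∷ w) with x ≟ᶠ y
... | yes _ = suffixAfter c x w
... | no  _ = suffixAfter (suc c) x w

length-suffixAfter-≤ : ∀ c (x : Fin n) w → length (suffixAfter c x w) ≤ length w
length-suffixAfter-≤ zero    x w       = ≤-refl
length-suffixAfter-≤ (suc c) x []      = z≤n
length-suffixAfter-≤ (suc c) x (y ∷ w) with x ≟ᶠ y
... | yes _ = m≤n⇒m≤1+n (length-suffixAfter-≤ c x w)
... | no  _ = m≤n⇒m≤1+n (length-suffixAfter-≤ (suc c) x w)

suffixAfter-here : ∀ c (x : Fin n) w → suffixAfter (suc c) x (x ∷ w) ≡ suffixAfter c x w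
suffixAfter-here c x w with x ≟ᶠ x
... | yes _   = refl
... | no  x≢x = contradiction refl x≢x

suffixAfter-there : ∀ c {x y : Fin n} w → x ≢ y → suffixAfter (suc c) x (y ∷ w) ≡ suffixAfter (suc c) x w
suffixAfter-there c {x} {y} w x≢y with x ≟ᶠ y
... | yes x≡y = contradiction x≡y x≢y
... | no  _   = refl

suffixAfter-++ : ∀ c (x : Fin n) u w → occ x u ≡ 0 → suffixAfter (suc c) x (u ++ w) ≡ suffixAfter (suc c) x w
suffixAfter-++ c x []      w _       = refl
suffixAfter-++ c x (y ∷ u) w occ≡0 = trans (suffixAfter-there c (u ++ w) x≢y)
  (suffixAfter-++ c x u w (trans (sym (occ-there u x≢y)) occ≡0))
  where
  x≢y : x ≢ y
  x≢y = occ≡0⇒≢ u occ≡0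

length-suffixAfter-≥ : ∀ c (x : Fin n) u w → c ≤ occ x u → length w ≤ length (suffixAfter c x (u ++ w))
length-suffixAfter-≥ zero    x u       w _   = List.length-++-≤ʳ w {u}
length-suffixAfter-≥ (suc c) x (y ∷ u) w c<occ = by-cases (x ≟ᶠ y)
  where
  by-cases : Dec (x ≡ y) → length w ≤ length (suffixAfter (suc c) x (y ∷ u ++ w))
  by-cases (yes refl) = subst (λ s → length w ≤ length s) (sym (suffixAfter-here c x (u ++ w)))
    (length-suffixAfter-≥ c x u w (s≤s⁻¹ (subst (suc c ≤_) (occ-here x u) c<occ)))
  by-cases (no x≢y)   = subst (λ s → length w ≤ length s) (sym (suffixAfter-there c (u ++ w) x≢y))
    (length-suffixAfter-≥ (suc c) x u w (subst (suc c ≤_) (occ-there u x≢y) c<occ))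

tailLength : Word (suc k) → ℕ
tailLength {k} w = length (suffixAfter 2 (fromℕ k) w)

tailLength-insertMax : (α β δ : Word (suc k)) → tailLength (insertMax α β δ) ≡ suc (length δ)
tailLength-insertMax {k} α β δ = begin
  length (suffixAfter 2 ω (map inject₁ α ++ ω ∷ map inject₁ β ++ ω ∷ map inject₁ δ ++ ω ∷ []))
    ≡⟨ cong length (suffixAfter-++ 1 ω (map inject₁ α) _ (occ-fromℕ-inject₁ α)) ⟩
  length (suffixAfter 2 ω (ω ∷ map inject₁ β ++ ω ∷ map inject₁ δ ++ ω ∷ []))
    ≡⟨ cong length (suffixAfter-here 1 ω _) ⟩
  length (suffixAfter 1 ω (map inject₁ β ++ ω ∷ map inject₁ δ ++ ω ∷ []))
    ≡⟨ cong length (suffixAfter-++ 0 ω (map inject₁ β) _ (occ-fromℕ-inject₁ β)) ⟩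
  length (suffixAfter 1 ω (ω ∷ map inject₁ δ ++ ω ∷ []))
    ≡⟨ cong length (suffixAfter-here 0 ω _) ⟩
  length (map inject₁ δ ++ ω ∷ [])
    ≡⟨ List.length-++ (map inject₁ δ) ⟩
  length (map inject₁ δ) + 1
    ≡⟨ +-comm _ 1 ⟩
  suc (length (map inject₁ δ))
    ≡⟨ cong suc (List.length-map inject₁ δ) ⟩
  suc (length δ) ∎
  where
  open ≡-Reasoning
  ω : Fin (suc (suc k))
  ω = fromℕ (suc k)

-- Inserting three copies of a new largest letter

splits : List A → List (List A × List A)
splits []       = ([] , []) ∷ []
splits (x ∷ xs) = ([] , x ∷ xs) ∷ map (λ (α , β) → x ∷ α , β) (splits xs)

length-splits : (xs : List A) → length (splits xs) ≡ suc (length xs)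
length-splits []       = refl
length-splits (x ∷ xs) = cong suc (trans (List.length-map _ (splits xs)) (length-splits xs))

∈-splits : (α β : List A) → (α , β) ∈ splits (α ++ β)
∈-splits []      []      = here refl
∈-splits []      (x ∷ β) = here refl
∈-splits (x ∷ α) β       = there (∈.∈-map⁺ _ (∈-splits α β))

take-length-++ : (xs ys : List A) → take (length xs) (xs ++ ys) ≡ xs
take-length-++ []       ys = refl
take-length-++ (x ∷ xs) ys = cong (x ∷_) (take-length-++ xs ys)

drop-length-++ : (xs ys : List A) → drop (length xs) (xs ++ ys) ≡ ys
drop-length-++ []       ys = refl
drop-length-++ (x ∷ xs) ys = drop-length-++ xs ys

insertionsAt : Word (suc k) → ℕ → List (Word (suc (suc k)))
insertionsAt v i = map (λ (α , β) → insertMax α β (drop i v)) (splits (take i v))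

insertions : Word (suc k) → ℕ → List (Word (suc (suc k)))
insertions v zero    = insertionsAt v (length v)
insertions v (suc d) = insertionsAt v (length v ∸ suc d) ++ insertions v d

∈-insertionsAt : (α β δ : Word (suc k)) → insertMax α β δ ∈ insertionsAt ((α ++ β) ++ δ) (length (α ++ β))
∈-insertionsAt α β δ rewrite take-length-++ (α ++ β) δ | drop-length-++ (α ++ β) δ =
  ∈.∈-map⁺ _ (∈-splits α β)

∈-insertions : (α β δ : Word (suc k)) (q : ℕ) → length δ ≤ q → insertMax α β δ ∈ insertions (α ++ β ++ δ) q
∈-insertions {k} α β δ q δ≤q = subst (λ v → insertMax α β δ ∈ insertions v q) (List.++-assoc α β δ) (go q δ≤q)
  where
  v : Word (suc k)
  v = (α ++ β) ++ δ
  split-point : length v ∸ length δ ≡ length (α ++ β)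
  split-point = trans (cong (_∸ length δ) (List.length-++ (α ++ β))) (m+n∸n≡m _ (length δ))
  go : ∀ q → length δ ≤ q → insertMax α β δ ∈ insertions v q
  go zero    δ≤0 = subst (λ i → insertMax α β δ ∈ insertionsAt v i)
    (trans (sym split-point) (cong (length v ∸_) (n≤0⇒n≡0 δ≤0))) (∈-insertionsAt α β δ)
  go (suc q) δ≤q with m≤n⇒m<n∨m≡n δ≤q
  ... | inj₁ δ<q   = ∈.∈-++⁺ʳ (insertionsAt v _) (go q (s≤s⁻¹ δ<q))
  ... | inj₂ δ≡q   = ∈.∈-++⁺ˡ (subst (λ i → insertMax α β δ ∈ insertionsAt v i)
                       (trans (sym split-point) (cong (length v ∸_) δ≡q)) (∈-insertionsAt α β δ))

weight : Word (suc k) → ℕ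
weight w = 2 ^ tailLength w

weight-insertionsAt : (v : Word (suc k)) (i : ℕ) → i ≤ length v →
                      sumBy weight (insertionsAt v i) ≡ suc i * 2 ^ suc (length v ∸ i)
weight-insertionsAt v i i≤v = begin
  sumBy weight (insertionsAt v i)
    ≡⟨ sumBy-map weight _ (splits (take i v)) ⟩
  sumBy (λ (α , β) → weight (insertMax α β (drop i v))) (splits (take i v))
    ≡⟨ sumBy-cong (splits (take i v)) (λ {(α , β)} _ → cong (2 ^_) (tailLength-insertMax α β (drop i v))) ⟩
  sumBy (λ _ → 2 ^ suc (length (drop i v))) (splits (take i v))
    ≡⟨ sumBy-const _ (splits (take i v)) ⟩
  length (splits (take i v)) * 2 ^ suc (length (drop i v))
    ≡⟨ cong₂ (λ a b → a * 2 ^ suc b) length-prefix (List.length-drop i v) ⟩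
  suc i * 2 ^ suc (length v ∸ i) ∎
  where
  open ≡-Reasoning
  length-prefix : length (splits (take i v)) ≡ suc i
  length-prefix = trans (length-splits (take i v)) (cong suc (trans (List.length-take i v) (m≤n⇒m⊓n≡m i≤v)))

insertionWeight : ℕ → ℕ → ℕ
insertionWeight L zero    = suc (L ∸ 0) * 2 ^ 1
insertionWeight L (suc d) = suc (L ∸ suc d) * 2 ^ suc (suc d) + insertionWeight L d

weight-insertions : (v : Word (suc k)) (q : ℕ) → q ≤ length v →
                    sumBy weight (insertions v q) ≡ insertionWeight (length v) q
weight-insertions v zero    _   = trans (weight-insertionsAt v (length v) ≤-refl)
                                        (cong (λ d → suc (length v) * 2 ^ suc d) (n∸n≡0 (length v)))
weight-insertions v (suc q) q<v = begin
  sumBy weight (insertionsAt v (length v ∸ suc q) ++ insertions v q)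
    ≡⟨ sumBy-++ weight (insertionsAt v (length v ∸ suc q)) (insertions v q) ⟩
  sumBy weight (insertionsAt v (length v ∸ suc q)) + sumBy weight (insertions v q)
    ≡⟨ cong₂ _+_ (weight-insertionsAt v _ (m∸n≤m (length v) (suc q))) (weight-insertions v q (<⇒≤ q<v)) ⟩
  suc (length v ∸ suc q) * 2 ^ suc (length v ∸ (length v ∸ suc q)) + insertionWeight (length v) q
    ≡⟨ cong (λ d → suc (length v ∸ suc q) * 2 ^ suc d + insertionWeight (length v) q) (m∸[m∸n]≡n q<v) ⟩
  insertionWeight (length v) (suc q) ∎
  where open ≡-Reasoning

insertionWeight-closed : ∀ L q → q ≤ L → insertionWeight L q + 2 ^ (2 + q) * q + (2 * L + 6) ≡ 2 ^ (2 + q) * (L + 2)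
insertionWeight-closed L zero    _   = base L
  where
  base : ∀ L → suc L * 2 + 4 * 0 + (2 * L + 6) ≡ 4 * (L + 2)
  base = solve-∀
insertionWeight-closed L (suc q) q<L with r , refl ← m≤n⇒∃[o]m+o≡n q<L = +-cancelʳ-≡ (P * q) _ _ (begin
  suc (L ∸ suc q) * P + S + 2 * P * suc q + D + P * q
    ≡⟨ cong (λ r′ → suc r′ * P + S + 2 * P * suc q + D + P * q) (m+n∸m≡n (suc q) r) ⟩
  suc r * P + S + 2 * P * suc q + D + P * q
    ≡⟨ regroup (suc r * P) S (2 * P * suc q) D (P * q) ⟩
  suc r * P + 2 * P * suc q + (S + P * q + D)
    ≡⟨ cong (suc r * P + 2 * P * suc q +_) (insertionWeight-closed L q (<⇒≤ q<L)) ⟩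
  suc r * P + 2 * P * suc q + P * (L + 2)
    ≡⟨ expand r P q ⟩
  2 * P * (L + 2) + P * q ∎)
  where
  open ≡-Reasoning
  P : ℕ
  P = 2 ^ (2 + q)
  S : ℕ
  S = insertionWeight L q
  D : ℕ
  D = 2 * L + 6
  regroup : ∀ a s b d c → a + s + b + d + c ≡ a + b + (s + c + d)
  regroup = solve-∀
  expand : ∀ r P q → suc r * P + 2 * P * suc q + P * (suc q + r + 2) ≡ 2 * P * (suc q + r + 2) + P * q
  expand = solve-∀

-- For small q the slack 6k + 12 of the closed form pays for the excess 20 · 2 ^ q.
insertionWeight-bound : ∀ k q → 320 ≤ k → q ≤ 3 * suc k → insertionWeight (3 * suc k) q ≤ 12 * k * 2 ^ q
insertionWeight-bound k q 320≤k q≤L = +-cancelʳ-≤ R (insertionWeight L q) (12 * k * X) (begin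
  insertionWeight L q + R                             ≡⟨ regroup (insertionWeight L q) X q k ⟩
  insertionWeight L q + 2 ^ (2 + q) * q + (2 * L + 6) ≡⟨ insertionWeight-closed L q q≤L ⟩
  2 ^ (2 + q) * (L + 2)                               ≡⟨ expand X k ⟩
  12 * k * X + 20 * X                                 ≤⟨ +-monoʳ-≤ (12 * k * X) excess≤slack ⟩
  12 * k * X + R                                      ∎)
  where
  open ≤-Reasoning
  L : ℕ
  L = 3 * suc k
  X : ℕ
  X = 2 ^ q
  R : ℕ
  R = 4 * X * q + (6 * k + 12)
  regroup : ∀ S X q k → S + (4 * X * q + (6 * k + 12)) ≡ S + 2 * (2 * X) * q + (2 * (3 * suc k) + 6)
  regroup = solve-∀
  expand : ∀ X k → 2 * (2 * X) * (3 * suc k + 2) ≡ 12 * k * X + 20 * X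
  expand = solve-∀
  excess≤slack : 20 * X ≤ R
  excess≤slack with 5 ≤? q
  ... | yes 5≤q = begin
    20 * X       ≡⟨ *-comm 20 X ⟩
    X * 20       ≤⟨ *-monoʳ-≤ X (*-monoʳ-≤ 4 5≤q) ⟩
    X * (4 * q)  ≡⟨ *-assoc X 4 q ⟨
    X * 4 * q    ≡⟨ cong (_* q) (*-comm X 4) ⟩
    4 * X * q    ≤⟨ m≤m+n (4 * X * q) _ ⟩
    R            ∎
  ... | no  q≱5 = begin
    20 * X       ≤⟨ *-monoʳ-≤ 20 (^-monoʳ-≤ 2 (s≤s⁻¹ (≰⇒> q≱5))) ⟩
    320          ≤⟨ 320≤k ⟩
    k            ≤⟨ m≤n*m k 6 ⟩
    6 * k        ≤⟨ m≤m+n _ 12 ⟩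
    6 * k + 12   ≤⟨ m≤n+m (6 * k + 12) (4 * X * q) ⟩
    R            ∎

allWords-suc : ∀ n L → allWords n (suc L) ≡ cartesianProductWith (λ w x → x ∷ w) (allWords n L) (allFin n)
allWords-suc n L = go (allWords n L)
  where
  go : ∀ ws → concatMap (λ w → map (_∷ w) (allFin n)) ws ≡ cartesianProductWith (λ w x → x ∷ w) ws (allFin n)
  go []       = refl
  go (w ∷ ws) = cong (map (_∷ w) (allFin n) ++_) (go ws)

allWords-unique : ∀ n L → Unique (allWords n L)
allWords-unique n zero    = [] AllPairs.∷ AllPairs.[]
allWords-unique n (suc L) = subst Unique (sym (allWords-suc n L))
  (Unique.cartesianProductWith⁺ _ ∷-injective-swapped (allWords-unique n L) (Unique.allFin⁺ n))
  where
  ∷-injective-swapped : ∀ {w w′ : Word n} {x x′} → x ∷ w ≡ x′ ∷ w′ → w ≡ w′ × x ≡ x′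
  ∷-injective-swapped eq = List.∷-injectiveʳ eq , List.∷-injectiveˡ eq

∈-allWords⇒length : ∀ n L {w : Word n} → w ∈ allWords n L → length w ≡ L
∈-allWords⇒length n zero    (here refl) = refl
∈-allWords⇒length n (suc L) w∈ with ∈.∈-cartesianProductWith⁻ _ (allWords n L) (allFin n) (subst (_ ∈_) (allWords-suc n L) w∈)
... | w , x , w∈allWords , _ , refl = cong suc (∈-allWords⇒length n L w∈allWords)

∈-allWords : ∀ n (w : Word n) → w ∈ allWords n (length w)
∈-allWords n []      = here refl
∈-allWords n (x ∷ w) = subst ((x ∷ w) ∈_) (sym (allWords-suc n (length w)))
  (∈.∈-cartesianProductWith⁺ _ (∈-allWords n w) (∈.∈-allFin x))

𝒜 : (n : ℕ) → List (Word n)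
𝒜 n = filter (inA? n) (allWords n (3 * n))

∈𝒜⇒InA : ∀ {w : Word n} → w ∈ 𝒜 n → InA n w
∈𝒜⇒InA {n} w∈ = proj₂ (∈.∈-filter⁻ (inA? n) {xs = allWords n (3 * n)} w∈)

∈𝒜⇒length : ∀ {w : Word n} → w ∈ 𝒜 n → length w ≡ 3 * n
∈𝒜⇒length {n} w∈ = ∈-allWords⇒length n (3 * n) (proj₁ (∈.∈-filter⁻ (inA? n) {xs = allWords n (3 * n)} w∈))

InA⇒∈𝒜 : ∀ {w : Word n} → InA n w → length w ≡ 3 * n → w ∈ 𝒜 n
InA⇒∈𝒜 {n} {w} w∈A length≡ = ∈.∈-filter⁺ (inA? n) (subst (λ L → w ∈ allWords n L) length≡ (∈-allWords n w)) w∈A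

-- The weighted count

length-eraseMax : (w : Word (suc m)) → length w ≡ length (eraseMax w) + occ (fromℕ m) w
length-eraseMax []      = refl
length-eraseMax {m} (x ∷ w) with lower₁? x in e
... | just j  with refl ← lower₁?≡just⇒ x e =
  cong suc (trans (length-eraseMax w) (cong (length (eraseMax w) +_) (sym (occ-there w (inject₁≢fromℕ j ∘ sym)))))
... | nothing with refl ← lower₁?≡nothing⇒ x e =
  trans (cong suc (length-eraseMax w))
    (trans (sym (+-suc (length (eraseMax w)) _)) (cong (length (eraseMax w) +_) (sym (occ-here _ w))))

eraseMax-∈𝒜 : ∀ {w : Word (suc m)} → w ∈ 𝒜 (suc m) → eraseMax w ∈ 𝒜 m
eraseMax-∈𝒜 {m} {w} w∈𝒜 = InA⇒∈𝒜 (InA-eraseMax w w∈A) (+-cancelʳ-≡ 3 _ _ (begin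
  length (eraseMax w) + 3                     ≡⟨ cong (length (eraseMax w) +_) (proj₁ w∈A (fromℕ m)) ⟨
  length (eraseMax w) + occ (fromℕ m) w       ≡⟨ length-eraseMax w ⟨
  length w                                    ≡⟨ ∈𝒜⇒length w∈𝒜 ⟩
  3 * suc m                                   ≡⟨ *-suc 3 m ⟩
  3 + 3 * m                                   ≡⟨ +-comm 3 (3 * m) ⟩
  3 * m + 3                                   ∎))
  where
  open ≡-Reasoning
  w∈A : InA (suc m) w
  w∈A = ∈𝒜⇒InA w∈𝒜

candidates : Word (suc k) → List (Word (suc (suc k)))
candidates v = insertions v (tailLength v)

∈-candidates : ∀ {w : Word (suc (suc k))} → w ∈ 𝒜 (suc (suc k)) → w ∈ concatMap candidates (𝒜 (suc k))
∈-candidates {k} {w} w∈𝒜 with α , β , δ , refl , second-max-twice ← decompose w (∈𝒜⇒InA w∈𝒜) =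
  ∈.∈-concatMap⁺ candidates (lose v∈𝒜 (∈-insertions α β δ (tailLength v) δ≤tail))
  where
  v : Word (suc k)
  v = α ++ β ++ δ
  v∈𝒜 : v ∈ 𝒜 (suc k)
  v∈𝒜 = subst (_∈ 𝒜 (suc k)) (eraseMax-insertMax α β δ) (eraseMax-∈𝒜 w∈𝒜)
  δ≤tail : length δ ≤ tailLength v
  δ≤tail = subst (λ u → length δ ≤ length (suffixAfter 2 (fromℕ k) u)) (List.++-assoc α β δ)
             (length-suffixAfter-≥ 2 (fromℕ k) (α ++ β) δ second-max-twice)

weight-candidates : ∀ {v : Word (suc k)} → 320 ≤ k → v ∈ 𝒜 (suc k) → sumBy weight (candidates v) ≤ 12 * k * weight v
weight-candidates {k} {v} 320≤k v∈𝒜 = begin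
  sumBy weight (candidates v)                 ≡⟨ weight-insertions v (tailLength v) tail≤v ⟩
  insertionWeight (length v) (tailLength v)   ≡⟨ cong (λ L → insertionWeight L (tailLength v)) (∈𝒜⇒length v∈𝒜) ⟩
  insertionWeight (3 * suc k) (tailLength v)  ≤⟨ insertionWeight-bound k (tailLength v) 320≤k
                                                   (subst (tailLength v ≤_) (∈𝒜⇒length v∈𝒜) tail≤v) ⟩
  12 * k * weight v                           ∎
  where
  open ≤-Reasoning
  tail≤v : tailLength v ≤ length v
  tail≤v = length-suffixAfter-≤ 2 (fromℕ k) v

weightedCount : ℕ → ℕ
weightedCount k = sumBy weight (𝒜 (suc k))

a≤weightedCount : ∀ k → a (suc k) ≤ weightedCount k
a≤weightedCount k = go (𝒜 (suc k))
  where
  go : (ws : List (Word (suc k))) → length ws ≤ sumBy weight ws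
  go []       = z≤n
  go (w ∷ ws) = +-mono-≤ (m^n>0 2 (tailLength w)) (go ws)

weightedCount-suc : ∀ k → 320 ≤ k → weightedCount (suc k) ≤ 12 * k * weightedCount k
weightedCount-suc k 320≤k = begin
  sumBy weight (𝒜 (2 + k))                          ≤⟨ sumBy-⊆ weight _ 𝒜-unique ∈-candidates ⟩
  sumBy weight (concatMap candidates (𝒜 (suc k)))   ≡⟨ sumBy-concatMap weight candidates (𝒜 (suc k)) ⟩
  sumBy (sumBy weight ∘ candidates) (𝒜 (suc k))     ≤⟨ sumBy-mono (𝒜 (suc k)) (weight-candidates 320≤k) ⟩
  sumBy (λ v → 12 * k * weight v) (𝒜 (suc k))       ≡⟨ sumBy-*ˡ (12 * k) weight (𝒜 (suc k)) ⟩
  12 * k * weightedCount k                          ∎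
  where
  open ≤-Reasoning
  𝒜-unique : Unique (𝒜 (2 + k))
  𝒜-unique = Unique.filter⁺ (inA? (2 + k)) (allWords-unique (2 + k) (3 * (2 + k)))

-- Exponential partial sums

expPartialScaled-suc : ∀ x K → expPartialScaled x (suc K) ≡ suc K * expPartialScaled x K + x ^ suc K
expPartialScaled-suc x K = begin
  sumBy (term (suc K)) (upTo (suc (suc K)))
    ≡⟨ cong (sumBy (term (suc K))) (List.applyUpTo-∷ʳ (λ i → i) (suc K)) ⟨
  sumBy (term (suc K)) (upTo (suc K) ++ suc K ∷ [])
    ≡⟨ sumBy-++ (term (suc K)) (upTo (suc K)) (suc K ∷ []) ⟩
  sumBy (term (suc K)) (upTo (suc K)) + (term (suc K) (suc K) + 0)
    ≡⟨ cong₂ _+_ (sumBy-cong (upTo (suc K)) term-suc) last-term ⟩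
  sumBy (λ k → suc K * term K k) (upTo (suc K)) + x ^ suc K
    ≡⟨ cong (_+ x ^ suc K) (sumBy-*ˡ (suc K) (term K) (upTo (suc K))) ⟩
  suc K * expPartialScaled x K + x ^ suc K ∎
  where
  open ≡-Reasoning
  term : ℕ → ℕ → ℕ
  term K k = x ^ k * ((K !) / (k !)) {{k !≢0}}
  term-suc : ∀ {k} → k ∈ upTo (suc K) → term (suc K) k ≡ suc K * term K k
  term-suc {k} k∈ = begin
    x ^ k * ((suc K * K !) / k !) {{k !≢0}}  ≡⟨ cong (x ^ k *_) (*-/-assoc (suc K) {{k !≢0}} (m≤n⇒m!∣n! (s≤s⁻¹ (∈.∈-upTo⁻ k∈)))) ⟩
    x ^ k * (suc K * ((K !) / k !) {{k !≢0}}) ≡⟨ *-CS.x∙yz≈y∙xz (x ^ k) (suc K) _ ⟩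
    suc K * term K k                         ∎
  last-term : term (suc K) (suc K) + 0 ≡ x ^ suc K
  last-term = trans (+-identityʳ _) (trans (cong (x ^ suc K *_) (n/n≡1 (suc K !) {{suc K !≢0}})) (*-identityʳ _))

[m+j]!≤m!*[m+j]^j : ∀ m j → (m + j) ! ≤ m ! * (m + j) ^ j
[m+j]!≤m!*[m+j]^j m zero    rewrite +-identityʳ m = ≤-reflexive (sym (*-identityʳ _))
[m+j]!≤m!*[m+j]^j m (suc j) rewrite +-suc m j = begin
  suc (m + j) * (m + j) !               ≤⟨ *-monoʳ-≤ (suc (m + j)) ([m+j]!≤m!*[m+j]^j m j) ⟩
  suc (m + j) * (m ! * (m + j) ^ j)     ≤⟨ *-monoʳ-≤ (suc (m + j)) (*-monoʳ-≤ (m !) (^-monoˡ-≤ j (n≤1+n (m + j)))) ⟩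
  suc (m + j) * (m ! * suc (m + j) ^ j) ≡⟨ *-CS.x∙yz≈y∙xz (suc (m + j)) (m !) _ ⟩
  m ! * suc (m + j) ^ suc j             ∎
  where open ≤-Reasoning

n!*n^j≤[n+j]! : ∀ n j → n ! * n ^ j ≤ (n + j) !
n!*n^j≤[n+j]! n zero    rewrite +-identityʳ n = ≤-reflexive (*-identityʳ _)
n!*n^j≤[n+j]! n (suc j) rewrite +-suc n j = begin
  n ! * (n * n ^ j)       ≡⟨ *-CS.x∙yz≈y∙xz (n !) n (n ^ j) ⟩
  n * (n ! * n ^ j)       ≤⟨ *-mono-≤ (m≤n⇒m≤1+n (m≤m+n n j)) (n!*n^j≤[n+j]! n j) ⟩
  suc (n + j) * (n + j) ! ∎
  where open ≤-Reasoning

n!*n^k≤n^n*k! : ∀ n k → n ! * n ^ k ≤ n ^ n * k !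
n!*n^k≤n^n*k! n k with ≤-total k n
... | inj₁ k≤n with j , refl ← m≤n⇒∃[o]m+o≡n k≤n = begin
  (k + j) ! * (k + j) ^ k           ≤⟨ *-monoˡ-≤ _ ([m+j]!≤m!*[m+j]^j k j) ⟩
  k ! * (k + j) ^ j * (k + j) ^ k   ≡⟨ *-assoc (k !) _ _ ⟩
  k ! * ((k + j) ^ j * (k + j) ^ k) ≡⟨ cong (k ! *_) (^-distribˡ-+-* (k + j) j k) ⟨
  k ! * (k + j) ^ (j + k)           ≡⟨ cong (λ e → k ! * (k + j) ^ e) (+-comm j k) ⟩
  k ! * (k + j) ^ (k + j)           ≡⟨ *-comm (k !) _ ⟩
  (k + j) ^ (k + j) * k !           ∎
  where open ≤-Reasoning
... | inj₂ n≤k with j , refl ← m≤n⇒∃[o]m+o≡n n≤k = begin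
  n ! * n ^ (n + j)                 ≡⟨ cong (n ! *_) (^-distribˡ-+-* n n j) ⟩
  n ! * (n ^ n * n ^ j)             ≡⟨ *-CS.x∙yz≈y∙xz (n !) (n ^ n) (n ^ j) ⟩
  n ^ n * (n ! * n ^ j)             ≤⟨ *-monoʳ-≤ (n ^ n) (n!*n^j≤[n+j]! n j) ⟩
  n ^ n * (n + j) !                 ∎
  where open ≤-Reasoning

n!*expPartialScaled≤[1+K]*n^n*K! : ∀ n K → n ! * expPartialScaled n K ≤ suc K * (n ^ n * K !)
n!*expPartialScaled≤[1+K]*n^n*K! n zero    = ≤-trans (n!*n^k≤n^n*k! n 0) (≤-reflexive (sym (+-identityʳ _)))
n!*expPartialScaled≤[1+K]*n^n*K! n (suc K) = begin
  n ! * expPartialScaled n (suc K)                          ≡⟨ cong (n ! *_) (expPartialScaled-suc n K) ⟩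
  n ! * (suc K * expPartialScaled n K + n ^ suc K)          ≡⟨ distribute (n !) (suc K) _ _ ⟩
  suc K * (n ! * expPartialScaled n K) + n ! * n ^ suc K    ≤⟨ +-mono-≤ (*-monoʳ-≤ (suc K) (n!*expPartialScaled≤[1+K]*n^n*K! n K))
                                                                        (n!*n^k≤n^n*k! n (suc K)) ⟩
  suc K * (suc K * (n ^ n * K !)) + n ^ n * (suc K * K !)   ≡⟨ collect K (n ^ n) (K !) ⟩
  suc (suc K) * (n ^ n * suc K !)                           ∎
  where
  open ≤-Reasoning
  distribute : ∀ f k e p → f * (k * e + p) ≡ k * (f * e) + f * p
  distribute = solve-∀
  collect : ∀ K N F → suc K * (suc K * (N * F)) + N * (suc K * F) ≡ suc (suc K) * (N * (suc K * F))
  collect = solve-∀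

-- Beyond K = 2n the added term n ^ K is absorbed, since 2n ≤ K + 1.
n!*[expPartialScaled+n^K]≤ : ∀ n j → let K = 2 * n + j in
                             n ! * (expPartialScaled n K + n ^ K) ≤ (2 * n + 2) * (n ^ n * K !)
n!*[expPartialScaled+n^K]≤ n zero rewrite +-identityʳ (2 * n) = begin
  n ! * (expPartialScaled n K + n ^ K)                  ≡⟨ *-distribˡ-+ (n !) _ _ ⟩
  n ! * expPartialScaled n K + n ! * n ^ K              ≤⟨ +-mono-≤ (n!*expPartialScaled≤[1+K]*n^n*K! n K) (n!*n^k≤n^n*k! n K) ⟩
  suc K * (n ^ n * K !) + n ^ n * K !                   ≡⟨ collect n (n ^ n * K !) ⟩
  (2 * n + 2) * (n ^ n * K !)                           ∎
  where
  open ≤-Reasoning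
  K : ℕ
  K = 2 * n
  collect : ∀ n X → suc (2 * n) * X + X ≡ (2 * n + 2) * X
  collect = solve-∀
n!*[expPartialScaled+n^K]≤ n (suc j) rewrite +-suc (2 * n) j = begin
  n ! * (expPartialScaled n (suc K) + n ^ suc K)                  ≡⟨ cong (λ e → n ! * (e + n ^ suc K)) (expPartialScaled-suc n K) ⟩
  n ! * (suc K * expPartialScaled n K + n ^ suc K + n ^ suc K)    ≡⟨ distribute (n !) (suc K) _ n (n ^ K) ⟩
  suc K * (n ! * expPartialScaled n K) + 2 * n * (n ! * n ^ K)    ≤⟨ +-monoʳ-≤ _ (*-monoˡ-≤ (n ! * n ^ K) 2n≤1+K) ⟩
  suc K * (n ! * expPartialScaled n K) + suc K * (n ! * n ^ K)    ≡⟨ *-distribˡ-+ (suc K) (n ! * expPartialScaled n K) _ ⟨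
  suc K * (n ! * expPartialScaled n K + n ! * n ^ K)              ≡⟨ cong (suc K *_) (*-distribˡ-+ (n !) (expPartialScaled n K) _) ⟨
  suc K * (n ! * (expPartialScaled n K + n ^ K))                  ≤⟨ *-monoʳ-≤ (suc K) (n!*[expPartialScaled+n^K]≤ n j) ⟩
  suc K * ((2 * n + 2) * (n ^ n * K !))                           ≡⟨ collect K (2 * n + 2) (n ^ n) (K !) ⟩
  (2 * n + 2) * (n ^ n * suc K !)                                 ∎
  where
  open ≤-Reasoning
  K : ℕ
  K = 2 * n + j
  2n≤1+K : 2 * n ≤ suc K
  2n≤1+K = m≤n⇒m≤1+n (m≤m+n (2 * n) j)
  distribute : ∀ f k e n p → f * (k * e + n * p + n * p) ≡ k * (f * e) + 2 * n * (f * p)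
  distribute = solve-∀
  collect : ∀ K c N F → suc K * (c * (N * F)) ≡ c * (N * (suc K * F))
  collect = solve-∀

-- Every term n ^ k / k! is at most n ^ n / n!, and beyond k = 2n the terms at least halve.
n!*expPartialScaled≤ : ∀ n K → n ! * expPartialScaled n K ≤ (2 * n + 2) * (n ^ n * K !)
n!*expPartialScaled≤ n K with K ≤? 2 * n
... | yes K≤2n = ≤-trans (n!*expPartialScaled≤[1+K]*n^n*K! n K)
                   (*-monoˡ-≤ (n ^ n * K !) (≤-trans (m≤n⇒m≤1+n (s≤s K≤2n)) (≤-reflexive (+-comm 2 (2 * n)))))
... | no  K≰2n with j , refl ← m≤n⇒∃[o]m+o≡n (<⇒≤ (≰⇒> K≰2n)) =
  ≤-trans (*-monoʳ-≤ (n !) (m≤m+n (expPartialScaled n (2 * n + j)) _)) (n!*[expPartialScaled+n^K]≤ n j)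

factorial-growth : ∀ (g : ℕ → ℕ) c N → (∀ k → N ≤ k → g (suc k) ≤ c * suc k * g k) →
                   ∀ j → g (N + j) * N ! ≤ g N * c ^ j * (N + j) !
factorial-growth g c N step zero    rewrite +-identityʳ N = ≤-reflexive (cong (_* N !) (sym (*-identityʳ (g N))))
factorial-growth g c N step (suc j) rewrite +-suc N j = begin
  g (suc (N + j)) * N !                           ≤⟨ *-monoˡ-≤ (N !) (step (N + j) (m≤m+n N j)) ⟩
  c * suc (N + j) * g (N + j) * N !               ≡⟨ *-assoc (c * suc (N + j)) _ _ ⟩
  c * suc (N + j) * (g (N + j) * N !)             ≤⟨ *-monoʳ-≤ (c * suc (N + j)) (factorial-growth g c N step j) ⟩
  c * suc (N + j) * (g N * c ^ j * (N + j) !)     ≡⟨ regroup c (suc (N + j)) (g N) (c ^ j) ((N + j) !) ⟩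
  g N * (c * c ^ j) * (suc (N + j) * (N + j) !)   ∎
  where
  open ≤-Reasoning
  regroup : ∀ c s g p f → c * s * (g * p * f) ≡ g * (c * p) * (s * f)
  regroup = solve-∀

a≤12^m*m! : ∀ N → 320 ≤ N → ∀ m → N ≤ m → a (2 + m) ≤ weightedCount (suc N) * 12 ^ m * m !
a≤12^m*m! N 320≤N m N≤m with j , refl ← m≤n⇒∃[o]m+o≡n N≤m = begin
  a (2 + (N + j))                                  ≤⟨ a≤weightedCount (suc (N + j)) ⟩
  g (N + j)                                        ≤⟨ m≤m*n (g (N + j)) (N !) {{N !≢0}} ⟩
  g (N + j) * N !                                  ≤⟨ factorial-growth g 12 N step j ⟩
  g N * 12 ^ j * (N + j) !                         ≤⟨ *-monoˡ-≤ _ (*-monoʳ-≤ (g N) (^-monoʳ-≤ 12 (m≤n+m j N))) ⟩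
  weightedCount (suc N) * 12 ^ (N + j) * (N + j) ! ∎
  where
  open ≤-Reasoning
  g : ℕ → ℕ
  g = weightedCount ∘ suc
  step : ∀ k → N ≤ k → g (suc k) ≤ 12 * suc k * g k
  step k N≤k = weightedCount-suc (suc k) (m≤n⇒m≤1+n (≤-trans 320≤N N≤k))

-- Multiplying by (m + 1) turns m! into n! / n for n = m + 2, which meets the bound on n! · e^n.
≤12^m*m!⇒≤12^n*n^n : ∀ {x D} m K → x ≤ D * 12 ^ m * m ! → let n = 2 + m in
                     x * n * expPartialScaled n K ≤ 6 * D * 12 ^ n * n ^ n * K !
≤12^m*m!⇒≤12^n*n^n {x} {D} m K x≤ = *-cancelʳ-≤ _ _ (suc m) (begin
  x * (2 + m) * E * suc m                                      ≤⟨ *-monoˡ-≤ (suc m) (*-monoˡ-≤ E (*-monoˡ-≤ (2 + m) x≤)) ⟩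
  D * 12 ^ m * m ! * (2 + m) * E * suc m                       ≡⟨ regroup D (12 ^ m) (m !) m E ⟩
  D * 12 ^ m * ((2 + m) ! * E)                                 ≤⟨ *-monoʳ-≤ (D * 12 ^ m) (n!*expPartialScaled≤ (2 + m) K) ⟩
  D * 12 ^ m * ((2 * (2 + m) + 2) * ((2 + m) ^ (2 + m) * K !)) ≤⟨ *-monoʳ-≤ (D * 12 ^ m) (*-monoˡ-≤ _ 2n+2≤6[1+m]) ⟩
  D * 12 ^ m * (6 * suc m * ((2 + m) ^ (2 + m) * K !))         ≤⟨ *-monoˡ-≤ _ (*-monoʳ-≤ D (^-monoʳ-≤ 12 (m≤n+m m 2))) ⟩
  D * 12 ^ (2 + m) * (6 * suc m * ((2 + m) ^ (2 + m) * K !))   ≡⟨ collect D (12 ^ (2 + m)) m ((2 + m) ^ (2 + m)) (K !) ⟩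
  6 * D * 12 ^ (2 + m) * (2 + m) ^ (2 + m) * K ! * suc m       ∎)
  where
  open ≤-Reasoning
  E : ℕ
  E = expPartialScaled (2 + m) K
  regroup : ∀ D X F m E → D * X * F * (2 + m) * E * suc m ≡ D * X * ((2 + m) * (suc m * F) * E)
  regroup = solve-∀
  collect : ∀ D X m N F → D * X * (6 * suc m * (N * F)) ≡ 6 * D * X * N * F * suc m
  collect = solve-∀
  2n+2≤6[1+m] : 2 * (2 + m) + 2 ≤ 6 * suc m
  2n+2≤6[1+m] = subst₂ _≤_ (sym (lhs m)) (sym (rhs m)) (+-monoʳ-≤ 6 (*-monoˡ-≤ m {2} {6} (s≤s (s≤s z≤n))))
    where
    lhs : ∀ m → 2 * (2 + m) + 2 ≡ 6 + 2 * m
    lhs = solve-∀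
    rhs : ∀ m → 6 * suc m ≡ 6 + 6 * m
    rhs = solve-∀

asymptotic-bound : ∀ (x : ℕ → ℕ) D N → (∀ m → N ≤ m → x (2 + m) ≤ D * 12 ^ m * m !) →
                   ∀ n → 2 + N ≤ n → ∀ K → x n * n * expPartialScaled n K ≤ 6 * D * 12 ^ n * n ^ n * K !
asymptotic-bound x D N x≤ (suc zero)    (s≤s ()) K
asymptotic-bound x D N x≤ (suc (suc m)) 2+N≤n    K = ≤12^m*m!⇒≤12^n*n^n {D = D} m K (x≤ m (s≤s⁻¹ (s≤s⁻¹ 2+N≤n)))

lemma5 : ∃ λ C → ∃ λ N → ∀ n → N ≤ n → ∀ K →
           a n * n * expPartialScaled n K ≤ C * 12 ^ n * n ^ n * K !
lemma5 = 6 * weightedCount (suc N) , 2 + N , asymptotic-bound a (weightedCount (suc N)) N (a≤12^m*m! N ≤-refl)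
  where
  N : ℕ
  N = 320
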